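{- Let $S\subset\mathbb{Z}_+$ be a proper cofinite set, and let $n,\beta,m$ be positive integers with $\lfloor n/m\rfloor>2\beta$ and $\Lambda_n^\beta\neq\emptyset$. Let $Q_n$ be the uniform probability measure on $\Lambda_n^\beta$. Then for every value $\vec W$ of the decomposition vector with $\Lambda_{\vec W}\ne\emptyset$ and all real $y_1,\dots,y_{m+1}$, $$Q_n\left(\mathbf{L}_i=y_i\ \text{for all } 1\le i\le m+1\ \middle|\ \vec W\right)=\prod_{i=1}^{m+1}Q_n\left(\mathbf{L}_i=y_i\ \middle|\ \vec W\right),$$ where conditioning on $\vec W$ means conditioning on the event $\Lambda_{\vec W}$.
   Context: "Proper cofinite" means $\mathbb{Z}_+\setminus S$ is finite and nonempty. An $S$-restricted composition of $n$ is a finite sequence of elements of $S$ summing to $n$. $\Lambda_n^\beta$ is the set of $S$-restricted compositions of $n$ all of whose parts are at most $\beta$. Decomposition: for $\vec\lambda=(\lambda_1,\dots,\lambda_\tau)\in\Lambda_n^\beta$ ($\tau$ = number of parts) and $i=1,\dots,m$ let $\tau_i=\min\{t:\lambda_1+\dots+\lambda_t\ge i\lfloor n/m\rfloor\}$, and $\tau_0=0$. Define the (possibly empty) sequences $\Pi_0=(\lambda_{\tau_1},\dots,\lambda_{\tau_m})$, $\Pi_i=(\lambda_{\tau_{i-1}+1},\dots,\lambda_{\tau_i-1})$ for $1\le i\le m$, and $\Pi_{m+1}=(\lambda_{\tau_m+1},\dots,\lambda_\tau)$. For a finite sequence $\Pi$ of positive integers, $|\Pi|$ is the sum of its entries and $\mathbf{B}(\Pi)$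 the product of its entries ($\mathbf{B}$ of the empty sequence is $1$). For $1\le i\le m+1$ let $\pi_i=|\Pi_i|$, let $p_i=1+\lambda_1+\dots+\lambda_{\tau_{i-1}}$ (the position of the first unit belonging to $\Pi_i$ when $\vec\lambda$ is viewed as a row of $n$ units), $W_i=(\pi_i,p_i)$ and $\vec W(\vec\lambda)=(W_1,\dots,W_{m+1})$. For a value $\vec W$, $\Lambda_{\vec W}=\{\vec\lambda\in\Lambda_n^\beta:\vec W(\vec\lambda)=\vec W\}$. Finally $\mathbf{L}_i(\vec\lambda)=\log\mathbf{B}(\Pi_i(\vec\lambda))$. -}

module Defs where

open import Data.Bool using (Bool; true; false; _∧_; not; if_then_else_)
open import Data.Nat using (ℕ; zero; suc; _+_; _*_; _∸_; _≤ᵇ_; _≡ᵇ_; NonZero)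
open import Data.Nat.DivMod using (_/_)
open import Data.Product using (_×_; _,_)
open import Data.List using (List; []; _∷_; map; concatMap; upTo; take; drop; filterᵇ)
open import Data.Nat.ListAction using (sum; product)
open import Data.Bool.ListAction using (all; any)
import Data.List.Properties as LP
import Data.Product.Properties as PP
import Data.Nat as N
open import Relation.Nullary.Decidable using (isYes)

-- A proper cofinite S ⊆ ℤ₊ is represented by its finite complement E
-- (a finite list of positive integers, required nonempty in the theorem).
-- inS E k  ⇔  k ∈ S = ℤ₊ ∖ E.
inS : List ℕ → ℕ → Bool
inS E k = (1 ≤ᵇ k) ∧ not (any (λ e → e ≡ᵇ k) E)

words : List ℕ → ℕ → List (List ℕ)
words xs zero    = [] ∷ []
words xs (suc t) = concatMap (λ x → map (x ∷_) (words xs t)) xs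

-- all lists with entries in {1,…,β} of length ≤ n (each listed exactly once);
-- every composition of n with parts ≤ β is among them.
candidates : ℕ → ℕ → List (List ℕ)
candidates β n = concatMap (words (map suc (upTo β))) (upTo (suc n))

isInΛ : List ℕ → ℕ → ℕ → List ℕ → Bool
isInΛ E n β l = all (inS E) l ∧ all (λ x → x ≤ᵇ β) l ∧ (sum l ≡ᵇ n)

Λ : List ℕ → ℕ → ℕ → List (List ℕ)
Λ E n β = filterᵇ (isInΛ E n β) (candidates β n)

-- firstReach l T = min { t : λ₁ + … + λ_t ≥ T }  (0 if T = 0)
firstReach : List ℕ → ℕ → ℕ
firstReach l       zero    = 0
firstReach []      (suc _) = 0
firstReach (x ∷ l) (suc T) = suc (firstReach l (suc T ∸ x))

module _ (n m : ℕ) {{_ : NonZero m}} where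

  τ : List ℕ → ℕ → ℕ
  τ l i = firstReach l (i * (n / m))

  -- Π_i for 1 ≤ i ≤ m+1 (1-indexed list positions)
  Π : List ℕ → ℕ → List ℕ
  Π l i = if i ≤ᵇ m
          then take (τ l i ∸ 1 ∸ τ l (i ∸ 1)) (drop (τ l (i ∸ 1)) l)
          else drop (τ l m) l

  pos : List ℕ → ℕ → ℕ
  pos l i = suc (sum (take (τ l (i ∸ 1)) l))

  Wvec : List ℕ → List (ℕ × ℕ)
  Wvec l = map (λ i → (sum (Π l i) , pos l i)) (map suc (upTo (suc m)))

  B : List ℕ → ℕ → ℕ
  B l i = product (Π l i)

_==W_ : List (ℕ × ℕ) → List (ℕ × ℕ) → Bool
u ==W v = isYes (LP.≡-dec (PP.≡-dec N._≟_ N._≟_) u v)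

module Submission where

-- Since all parts are smaller than q = ⌊n/m⌋, each element of Λ_{W⃗} splits as
-- Π₁ λ_{τ₁} Π₂ ⋯ Π_m λ_{τ_m} Π_{m+1} with one cut part inside each window ((i-1)q, iq],
-- and W⃗ fixes every block sum |Π_i|. Replacing the i-th block of y ∈ Λ_{W⃗} by the i-th block
-- of x ∈ Λ_{W⃗} therefore leaves the cuts where they are and yields another element of Λ_{W⃗}:
-- Λ_{W⃗} is a product of its sets of blocks. In counting form, swapping blocks gives
-- #(A ∩ B)·#Λ_{W⃗} = #A·#B for a condition A on block i and a condition B on the other blocks,
-- and induction over the blocks yields the product formula for the events 𝐁(Π_i) = b_i,
-- i.e. 𝐋_i = log b_i.

open import Defs
open import Data.Nat using (ℕ; suc; _*_; _^_; _≤_; _<_; _≡ᵇ_; NonZero)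
open import Data.Nat.DivMod using (_/_)
open import Data.Fin using (Fin; toℕ)
open import Data.Bool using (_∧_)
open import Data.List using (List; []; length; map; filterᵇ; allFin)
open import Data.Nat.ListAction using (product)
open import Data.Bool.ListAction using (all)
open import Data.List.Relation.Unary.All using (All)
open import Data.Product using (_×_)
open import Relation.Binary.PropositionalEquality using (_≡_; _≢_)

open import Data.Bool using (Bool; true; false; T)
open import Data.Bool.Properties using (∧-identityʳ; T-∧)
open import Data.Nat using (zero; _+_; _∸_; _≟_; _≤?_; _≤ᵇ_; z≤n; s≤s)
open import Data.Nat.Properties
  using ( *-comm; *-assoc; *-monoˡ-≤; +-assoc; +-comm; +-suc; +-monoʳ-<; +-monoʳ-≤; +-mono-≤; +-∸-assoc; ∸-+-assoc
        ; <⇒≤; <⇒≱; ≰⇒>; ≤-refl; ≤-trans; ≤-pred; ≤-<-trans; ≤-antisym; n≤1+n; n≮n; suc-injective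
        ; m≤m+n; m≤n+m; m≤n⇒m<n∨m≡n; m≤n⇒m∸n≡0; m+n∸m≡n; m+[n∸m]≡n; m∸n+n≡m; m+n≤o⇒m≤o∸n
        ; m<n⇒0<n∸m; m≤n+o⇒m∸n≤o; ≤ᵇ⇒≤; ≤⇒≤ᵇ; ≡ᵇ⇒≡; ≡⇒≡ᵇ; module ≤-Reasoning)
open import Data.Nat.DivMod using (m/n*n≤m)
open import Data.Nat.ListAction using (sum)
open import Data.Nat.ListAction.Properties using (sum-++)
open import Data.Fin.Properties using (toℕ<n; toℕ-injective)
import Data.Fin as Fin
open import Data.Maybe using (fromMaybe)
open import Data.Product using (_,_; proj₁; proj₂; ∃)
open import Data.Sum using (inj₁; inj₂)
open import Data.List using (_∷_; _++_; take; drop; head; upTo; tabulate; cartesianProduct)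
open import Data.List.Properties
  using ( length-++; length-drop; length-tabulate; ++-assoc; ++-identityʳ; take++drop≡id
        ; map-cong; map-cong-local; ∷-injective; ∷-injectiveˡ; ∷-injectiveʳ)
open import Data.List.Membership.Propositional using (_∈_)
open import Data.List.Membership.Propositional.Properties
  using ( ∈-∃++; ∈-++⁻; ∈-++⁺ˡ; ∈-++⁺ʳ; ∈-map⁺; ∈-map⁻; ∈-filter⁺; ∈-filter⁻; ∈-concat⁻′; ∈-concatMap⁺
        ; ∈-upTo⁺; ∈-cartesianProduct⁺; ∈-cartesianProduct⁻)
open import Data.List.Relation.Unary.Any using (here; there)
import Data.List.Relation.Unary.Any as Any
open import Data.List.Relation.Unary.All using ([]; _∷_)
import Data.List.Relation.Unary.All as All
import Data.List.Relation.Unary.All.Properties as All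
open import Data.List.Relation.Unary.AllPairs using ([]; _∷_)
import Data.List.Relation.Unary.AllPairs as AllPairs
import Data.List.Relation.Unary.AllPairs.Properties as AllPairs
open import Data.List.Relation.Unary.Unique.Propositional using (Unique)
import Data.List.Relation.Unary.Unique.Propositional.Properties as Unique
open import Function using (_∘′_)
open import Function.Bundles using (Equivalence)
open import Relation.Nullary using (¬_; yes; no; contradiction)
open import Relation.Nullary.Decidable using (T?; toWitness; fromWitness)
open import Relation.Binary.PropositionalEquality using (refl; sym; trans; cong; cong₂; subst; module ≡-Reasoning)

private
  variable
    A C I : Set

-- Counting over a product structure

count : (A → Bool) → List A → ℕ
count p xs = length (filterᵇ p xs)

count-∧-filterᵇ : (p q : A → Bool) (xs : List A) →
          count (λ x → p x ∧ q x) xs ≡ count q (filterᵇ p xs)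
count-∧-filterᵇ p q [] = refl
count-∧-filterᵇ p q (x ∷ xs) with p x
... | false = count-∧-filterᵇ p q xs
... | true with q x
...   | true  = cong suc (count-∧-filterᵇ p q xs)
...   | false = count-∧-filterᵇ p q xs

count-cong : (p q : A → Bool) (xs : List A) →
             (∀ {x} → x ∈ xs → p x ≡ q x) → count p xs ≡ count q xs
count-cong p q [] _ = refl
count-cong p q (x ∷ xs) p≗q with p x | q x | p≗q (here refl)
... | true  | true  | _ = cong suc (count-cong p q xs (p≗q ∘′ there))
... | false | false | _ = count-cong p q xs (p≗q ∘′ there)

count-true : (xs : List A) → count (λ _ → true) xs ≡ length xs
count-true []       = refl
count-true (x ∷ xs) = cong suc (count-true xs)

count-false : (xs : List A) → count (λ _ → false) xs ≡ 0
count-false []       = refl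
count-false (x ∷ xs) = count-false xs

count-++ : (p : A → Bool) (xs ys : List A) → count p (xs ++ ys) ≡ count p xs + count p ys
count-++ p [] ys = refl
count-++ p (x ∷ xs) ys with p x
... | true  = cong suc (count-++ p xs ys)
... | false = count-++ p xs ys

count-map : (p : C → Bool) (f : A → C) (xs : List A) → count p (map f xs) ≡ count (λ x → p (f x)) xs
count-map p f [] = refl
count-map p f (x ∷ xs) with p (f x)
... | true  = cong suc (count-map p f xs)
... | false = count-map p f xs

count-cartesianProduct : (p : A → Bool) (q : C → Bool) (xs : List A) (ys : List C) →
  count (λ (z : A × C) → p (proj₁ z) ∧ q (proj₂ z)) (cartesianProduct xs ys) ≡ count p xs * count q ys
count-cartesianProduct p q [] ys = refl
count-cartesianProduct {A = A} {C = C} p q (x ∷ xs) ys =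
  begin
    count pq (map (x ,_) ys ++ cartesianProduct xs ys)
  ≡⟨ count-++ pq (map (x ,_) ys) _ ⟩
    count pq (map (x ,_) ys) + count pq (cartesianProduct xs ys)
  ≡⟨ cong₂ _+_ (count-map pq (x ,_) ys) (count-cartesianProduct p q xs ys) ⟩
    count (λ y → p x ∧ q y) ys + count p xs * count q ys
  ≡⟨ row ⟩
    count p (x ∷ xs) * count q ys
  ∎
  where
  open ≡-Reasoning
  pq : A × C → Bool
  pq z = p (proj₁ z) ∧ q (proj₂ z)
  row : count (λ y → p x ∧ q y) ys + count p xs * count q ys ≡ count p (x ∷ xs) * count q ys
  row with p x
  ... | true  = refl
  ... | false = cong (_+ count p xs * count q ys) (count-false ys)

∈-++-∷⁻ : {z x : A} (ys zs : List A) → z ∈ ys ++ x ∷ zs → z ≢ x → z ∈ ys ++ zs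
∈-++-∷⁻ ys zs z∈ z≢x with ∈-++⁻ ys z∈
... | inj₁ z∈ys         = ∈-++⁺ˡ z∈ys
... | inj₂ (here z≡x)   = contradiction z≡x z≢x
... | inj₂ (there z∈zs) = ∈-++⁺ʳ ys z∈zs

injective⇒length≤ : (f : A → C) {xs : List A} {ys : List C} → Unique xs →
  (∀ {x} → x ∈ xs → f x ∈ ys) →
  (∀ {x y} → x ∈ xs → y ∈ xs → f x ≡ f y → x ≡ y) →
  length xs ≤ length ys
injective⇒length≤ f {[]} _ _ _ = z≤n
injective⇒length≤ f {x ∷ xs} (x∉xs ∷ unique) into inj
  with ys₁ , ys₂ , refl ← ∈-∃++ (into (here refl)) =
  begin
    suc (length xs)                 ≤⟨ s≤s (injective⇒length≤ f unique into′ (λ p q → inj (there p) (there q))) ⟩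
    suc (length (ys₁ ++ ys₂))       ≡⟨ cong suc (length-++ ys₁) ⟩
    suc (length ys₁ + length ys₂)   ≡⟨ +-suc (length ys₁) _ ⟨
    length ys₁ + length (f x ∷ ys₂) ≡⟨ length-++ ys₁ ⟨
    length (ys₁ ++ f x ∷ ys₂)       ∎
  where
  open ≤-Reasoning
  into′ : ∀ {z} → z ∈ xs → f z ∈ ys₁ ++ ys₂
  into′ z∈xs = ∈-++-∷⁻ ys₁ ys₂ (into (there z∈xs))
    (λ fz≡fx → All.lookup x∉xs z∈xs (inj (here refl) (there z∈xs) (sym fz≡fx)))

module _ (σ : A → A) {xs : List A} (unique : Unique xs)
         (σ-∈ : ∀ {x} → x ∈ xs → σ x ∈ xs) (σ-involutive : ∀ {x} → x ∈ xs → σ (σ x) ≡ x) where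

  private
    count-∘-≤ : (g : A → Bool) → count (λ x → g (σ x)) xs ≤ count g xs
    count-∘-≤ g = injective⇒length≤ σ (Unique.filter⁺ (λ x → T? (g (σ x))) unique) into inj
      where
      into : ∀ {x} → x ∈ filterᵇ (λ x → g (σ x)) xs → σ x ∈ filterᵇ g xs
      into x∈ with x∈xs , gσx ← ∈-filter⁻ (λ x → T? (g (σ x))) x∈ =
        ∈-filter⁺ (λ x → T? (g x)) (σ-∈ x∈xs) gσx
      inj : ∀ {x y} → x ∈ filterᵇ (λ x → g (σ x)) xs → y ∈ filterᵇ (λ x → g (σ x)) xs → σ x ≡ σ y → x ≡ y
      inj {x} {y} x∈ y∈ σx≡σy = begin
        x       ≡⟨ σ-involutive (proj₁ (∈-filter⁻ (λ x → T? (g (σ x))) x∈)) ⟨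
        σ (σ x) ≡⟨ cong σ σx≡σy ⟩
        σ (σ y) ≡⟨ σ-involutive (proj₁ (∈-filter⁻ (λ x → T? (g (σ x))) y∈)) ⟩
        y       ∎
        where open ≡-Reasoning

  count-involution : (g : A → Bool) → count (λ x → g (σ x)) xs ≡ count g xs
  count-involution g = ≤-antisym (count-∘-≤ g) (begin
    count g xs                   ≡⟨ count-cong _ _ xs (λ x∈xs → cong g (σ-involutive x∈xs)) ⟨
    count (λ x → g (σ (σ x))) xs ≤⟨ count-∘-≤ (λ x → g (σ x)) ⟩
    count (λ x → g (σ x)) xs     ∎)
    where open ≤-Reasoning

-- Double counting on xs × xs: the involution (x , y) ↦ (swap x y , swap y x) turns p x ∧ r x into p x ∧ r y.
count-∧-swap : {xs : List A} → Unique xs → (swap : A → A → A) (p r : A → Bool) →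
  (∀ {x y} → x ∈ xs → y ∈ xs → swap x y ∈ xs) →
  (∀ {x y} → x ∈ xs → y ∈ xs → swap (swap x y) (swap y x) ≡ x) →
  (∀ {x y} → x ∈ xs → y ∈ xs → p (swap x y) ≡ p x) →
  (∀ {x y} → x ∈ xs → y ∈ xs → r (swap x y) ≡ r y) →
  count (λ x → p x ∧ r x) xs * length xs ≡ count p xs * count r xs
count-∧-swap {A = A} {xs = xs} unique swap p r swap-∈ swap-involutive p-swap r-swap =
  begin
    count (λ x → p x ∧ r x) xs * length xs
  ≡⟨ cong (count (λ x → p x ∧ r x) xs *_) (count-true xs) ⟨
    count (λ x → p x ∧ r x) xs * count (λ _ → true) xs
  ≡⟨ count-cartesianProduct (λ x → p x ∧ r x) (λ _ → true) xs xs ⟨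
    count (λ z → (p (proj₁ z) ∧ r (proj₁ z)) ∧ true) pairs
  ≡⟨ count-cong _ _ pairs diagonal≗swapped ⟩
    count (λ z → g (σ z)) pairs
  ≡⟨ count-involution σ (Unique.cartesianProduct⁺ unique unique) σ-∈ σ-involutive g ⟩
    count g pairs
  ≡⟨ count-cartesianProduct p r xs xs ⟩
    count p xs * count r xs
  ∎
  where
  open ≡-Reasoning
  pairs : List (A × A)
  pairs = cartesianProduct xs xs
  σ : A × A → A × A
  σ (x , y) = swap x y , swap y x
  g : A × A → Bool
  g (x , y) = p x ∧ r y
  σ-∈ : ∀ {z} → z ∈ pairs → σ z ∈ pairs
  σ-∈ z∈ with x∈ , y∈ ← ∈-cartesianProduct⁻ xs xs z∈ = ∈-cartesianProduct⁺ (swap-∈ x∈ y∈) (swap-∈ y∈ x∈)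
  σ-involutive : ∀ {z} → z ∈ pairs → σ (σ z) ≡ z
  σ-involutive z∈ with x∈ , y∈ ← ∈-cartesianProduct⁻ xs xs z∈ =
    cong₂ _,_ (swap-involutive x∈ y∈) (swap-involutive y∈ x∈)
  diagonal≗swapped : ∀ {z} → z ∈ pairs → (p (proj₁ z) ∧ r (proj₁ z)) ∧ true ≡ g (σ z)
  diagonal≗swapped z∈ with x∈ , y∈ ← ∈-cartesianProduct⁻ xs xs z∈ =
    trans (∧-identityʳ _) (sym (cong₂ _∧_ (p-swap x∈ y∈) (r-swap y∈ x∈)))

all-cong : (p q : A → Bool) (xs : List A) → (∀ {x} → x ∈ xs → p x ≡ q x) → all p xs ≡ all q xs
all-cong p q []       _   = refl
all-cong p q (x ∷ xs) p≗q = cong₂ _∧_ (p≗q (here refl)) (all-cong p q xs (p≗q ∘′ there))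

-- A product structure on xs: swap i x y takes coordinate i from x and all others from y.
record CoordinateSwaps (xs : List A) (P : I → A → Bool) : Set where
  field
    swap            : I → A → A → A
    swap-∈          : ∀ i {x y} → x ∈ xs → y ∈ xs → swap i x y ∈ xs
    swap-involutive : ∀ i {x y} → x ∈ xs → y ∈ xs → swap i (swap i x y) (swap i y x) ≡ x
    P-swap-same     : ∀ i {x y} → x ∈ xs → y ∈ xs → P i (swap i x y) ≡ P i x
    P-swap-other    : ∀ {i j} → j ≢ i → ∀ {x y} → x ∈ xs → y ∈ xs → P i (swap j x y) ≡ P i y

module _ {xs : List A} {P : I → A → Bool} (unique : Unique xs) (S : CoordinateSwaps xs P) where
  open CoordinateSwaps S

  count-all : (j : I) (J : List I) → Unique (j ∷ J) →
    count (λ x → all (λ i → P i x) (j ∷ J)) xs * length xs ^ length J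
      ≡ product (map (λ i → count (P i) xs) (j ∷ J))
  count-all j [] _ = cong (_* 1) (count-cong _ _ xs (λ _ → ∧-identityʳ _))
  count-all j (j′ ∷ J) (j∉J ∷ unique-J) =
    begin
      count (λ x → P j x ∧ R x) xs * (N * N ^ length J)
    ≡⟨ *-assoc (count (λ x → P j x ∧ R x) xs) N _ ⟨
      count (λ x → P j x ∧ R x) xs * N * N ^ length J
    ≡⟨ cong (_* N ^ length J) (count-∧-swap unique (swap j) (P j) R
                                 (swap-∈ j) (swap-involutive j) (P-swap-same j) R-swap) ⟩
      count (P j) xs * count R xs * N ^ length J
    ≡⟨ *-assoc (count (P j) xs) _ _ ⟩
      count (P j) xs * (count R xs * N ^ length J)
    ≡⟨ cong (count (P j) xs *_) (count-all j′ J unique-J) ⟩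
      count (P j) xs * product (map (λ i → count (P i) xs) (j′ ∷ J))
    ∎
    where
    open ≡-Reasoning
    N : ℕ
    N = length xs
    R : A → Bool
    R x = all (λ i → P i x) (j′ ∷ J)
    R-swap : ∀ {x y} → x ∈ xs → y ∈ xs → R (swap j x y) ≡ R y
    R-swap x∈ y∈ = all-cong _ _ (j′ ∷ J) (λ i∈ → P-swap-other (All.lookup j∉J i∈) x∈ y∈)

-- First passage of the prefix sums

firstReach-zero : (l : List ℕ) → firstReach l 0 ≡ 0
firstReach-zero []      = refl
firstReach-zero (_ ∷ _) = refl

firstReach-++ : (a b : List ℕ) (T : ℕ) → sum a < T → firstReach (a ++ b) T ≡ length a + firstReach b (T ∸ sum a)
firstReach-++ []      b T       _ = refl
firstReach-++ (x ∷ a) b (suc T) a<T = cong suc (begin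
    firstReach (a ++ b) (suc T ∸ x)
  ≡⟨ firstReach-++ a b (suc T ∸ x) (m+n≤o⇒m≤o∸n (suc (sum a)) a<T′) ⟩
    length a + firstReach b (suc T ∸ x ∸ sum a)
  ≡⟨ cong (λ t → length a + firstReach b t) (∸-+-assoc (suc T) x (sum a)) ⟩
    length a + firstReach b (suc T ∸ (x + sum a))
  ∎)
  where
  open ≡-Reasoning
  a<T′ : suc (sum a) + x ≤ suc T
  a<T′ = subst (_≤ suc T) (cong suc (+-comm x (sum a))) a<T

record Crossing (l : List ℕ) (T : ℕ) : Set where
  constructor crossing
  field
    before  : List ℕ
    part    : ℕ
    after   : List ℕ
    split   : l ≡ before ++ part ∷ after
    below   : sum before < T
    reached : T ≤ sum before + part

firstReach-crossing : ∀ {l T} → (c : Crossing l T) → firstReach l T ≡ suc (length (Crossing.before c))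
firstReach-crossing {T = T} (crossing a x r refl a<T T≤a+x) = begin
  firstReach (a ++ x ∷ r) T                      ≡⟨ firstReach-++ a (x ∷ r) T a<T ⟩
  length a + firstReach (x ∷ r) (T ∸ sum a)      ≡⟨ cong (length a +_) (reached-at-head (T ∸ sum a) 0<T∸a T∸a≤x) ⟩
  length a + 1                                   ≡⟨ +-comm (length a) 1 ⟩
  suc (length a)                                 ∎
  where
  open ≡-Reasoning
  0<T∸a : 0 < T ∸ sum a
  0<T∸a = m<n⇒0<n∸m a<T
  T∸a≤x : T ∸ sum a ≤ x
  T∸a≤x = m≤n+o⇒m∸n≤o T (sum a) T≤a+x
  reached-at-head : ∀ t → 0 < t → t ≤ x → firstReach (x ∷ r) t ≡ 1
  reached-at-head (suc t) _ t≤x = cong suc (trans (cong (firstReach r) (m≤n⇒m∸n≡0 t≤x)) (firstReach-zero r))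

crossing-∷ : ∀ {x l T} → x < T → Crossing l (T ∸ x) → Crossing (x ∷ l) T
crossing-∷ {x} {T = T} x<T (crossing a y r refl a<T′ T′≤a+y) =
  crossing (x ∷ a) y r refl
    (subst (x + sum a <_) (m+[n∸m]≡n (<⇒≤ x<T)) (+-monoʳ-< x a<T′))
    (subst (_≤ x + sum a + y) (m+[n∸m]≡n (<⇒≤ x<T))
      (subst (x + (T ∸ x) ≤_) (sym (+-assoc x (sum a) y)) (+-monoʳ-≤ x T′≤a+y)))

crossing-exists : (l : List ℕ) (T : ℕ) → 0 < T → T ≤ sum l → Crossing l T
crossing-exists []      T 0<T T≤0 = contradiction T≤0 (<⇒≱ 0<T)
crossing-exists (x ∷ l) T 0<T T≤sum with T ≤? x
... | yes T≤x = crossing [] x l refl 0<T T≤x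
... | no  T≰x = crossing-∷ (≰⇒> T≰x)
  (crossing-exists l (T ∸ x) (m<n⇒0<n∸m (≰⇒> T≰x)) (m≤n+o⇒m∸n≤o T x T≤sum))

firstReach-pos : (l : List ℕ) (T : ℕ) → 0 < T → T ≤ sum l → 0 < firstReach l T
firstReach-pos l T 0<T T≤sum = subst (0 <_) (sym (firstReach-crossing (crossing-exists l T 0<T T≤sum))) (s≤s z≤n)

-- With all parts below D, every window of length D contains a prefix sum.
firstReach-<-+ : (l : List ℕ) (T D : ℕ) → All (_< D) l → 0 < T → D + T ≤ sum l →
                 firstReach l T < firstReach l (D + T)
firstReach-<-+ [] T D _ 0<T D+T≤0 = contradiction D+T≤0 (<⇒≱ (≤-trans 0<T (m≤n+m T D)))
firstReach-<-+ (x ∷ l) (suc T) D (x<D ∷ l<D) _ D+T≤sum rewrite +-suc D T with suc T ≤? x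
... | yes T≤x rewrite m≤n⇒m∸n≡0 T≤x | firstReach-zero l =
  s≤s (firstReach-pos l (suc (D + T) ∸ x) (m<n⇒0<n∸m (≤-trans x<D (≤-trans (m≤m+n D T) (n≤1+n _))))
         (m≤n+o⇒m∸n≤o (suc (D + T)) x D+T≤sum))
... | no T≰x = s≤s (subst (λ t → firstReach l (suc T ∸ x) < firstReach l t) shift
  (firstReach-<-+ l (suc T ∸ x) D l<D (m<n⇒0<n∸m (≰⇒> T≰x))
    (subst (_≤ sum l) (sym shift) (m≤n+o⇒m∸n≤o (suc (D + T)) x D+T≤sum))))
  where
  shift : D + (suc T ∸ x) ≡ suc (D + T) ∸ x
  shift = trans (sym (+-∸-assoc D (<⇒≤ (≰⇒> T≰x)))) (cong (_∸ x) (+-suc D T))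

-- Blocks and cut parts

take-length-++ : (a b : List A) → take (length a) (a ++ b) ≡ a
take-length-++ []      b = refl
take-length-++ (x ∷ a) b = cong (x ∷_) (take-length-++ a b)

drop-length-++ : (a b : List A) → drop (length a) (a ++ b) ≡ b
drop-length-++ []      b = refl
drop-length-++ (x ∷ a) b = drop-length-++ a b

take-++-≤ : (k : ℕ) (a b : List A) → k ≤ length a → take k (a ++ b) ≡ take k a
take-++-≤ zero    a       b _         = refl
take-++-≤ (suc k) (x ∷ a) b (s≤s k≤a) = cong (x ∷_) (take-++-≤ k a b k≤a)

drop-++-≤ : (k : ℕ) (a b : List A) → k ≤ length a → drop k (a ++ b) ≡ drop k a ++ b
drop-++-≤ zero    a       b _         = refl
drop-++-≤ (suc k) (x ∷ a) b (s≤s k≤a) = drop-++-≤ k a b k≤a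

take-suc-length-++ : (a : List A) (x : A) (r : List A) → take (suc (length a)) (a ++ x ∷ r) ≡ a ++ x ∷ []
take-suc-length-++ []      x r = refl
take-suc-length-++ (y ∷ a) x r = cong (y ∷_) (take-suc-length-++ a x r)

map-cong-local⁻ : {f g : A → C} (xs : List A) → map f xs ≡ map g xs → All (λ x → f x ≡ g x) xs
map-cong-local⁻ []       _  = []
map-cong-local⁻ (x ∷ xs) eq with fx≡gx , eq′ ← ∷-injective eq = fx≡gx ∷ map-cong-local⁻ xs eq′

sum-++-cong : (a a′ b b′ : List ℕ) → sum a ≡ sum a′ → sum b ≡ sum b′ → sum (a ++ b) ≡ sum (a′ ++ b′)
sum-++-cong a a′ b b′ a≈a′ b≈b′ = trans (sum-++ a b) (trans (cong₂ _+_ a≈a′ b≈b′) (sym (sum-++ a′ b′)))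

module Decomposition (n m : ℕ) {{_ : NonZero m}} where

  q : ℕ
  q = n / m

  -- λ_{τ_i} (junk value 0 when τ_i is out of range)
  cutPart : List ℕ → ℕ → ℕ
  cutPart l i = fromMaybe 0 (head (drop (τ n m l i ∸ 1) l))

  Π-< : (l : List ℕ) (i : ℕ) → i < m →
        Π n m l (suc i) ≡ take (τ n m l (suc i) ∸ 1 ∸ τ n m l i) (drop (τ n m l i) l)
  Π-< l i i<m with suc i ≤ᵇ m | ≤⇒≤ᵇ i<m
  ... | true | _ = refl

  Π-last : (l : List ℕ) → Π n m l (suc m) ≡ drop (τ n m l m) l
  Π-last l with suc m ≤ᵇ m | ≤ᵇ⇒≤ (suc m) m
  ... | false | _     = refl
  ... | true  | 1+m≤m = contradiction (1+m≤m _) (n≮n m)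

  W-coordinate : List ℕ → ℕ → ℕ × ℕ
  W-coordinate l i = sum (Π n m l i) , pos n m l i

  Wvec-≡⁻ : {x y : List ℕ} → Wvec n m x ≡ Wvec n m y →
            (i : ℕ) → i ≤ m → W-coordinate x (suc i) ≡ W-coordinate y (suc i)
  Wvec-≡⁻ W≡ i i≤m =
    All.applyUpTo⁻ (λ i → i) (suc m) (All.map⁻ (map-cong-local⁻ (map suc (upTo (suc m))) W≡)) (s≤s i≤m)

  Wvec-≡⁺ : {x y : List ℕ} → (∀ i → i ≤ m → W-coordinate x (suc i) ≡ W-coordinate y (suc i)) →
            Wvec n m x ≡ Wvec n m y
  Wvec-≡⁺ W≡ = map-cong-local (All.map⁺ (All.applyUpTo⁺₁ (λ i → i) (suc m) (λ { (s≤s i≤m) → W≡ _ i≤m })))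

  -- λ⃗ = Π₁ λ_{τ₁} Π₂ ⋯ Π_m λ_{τ_m} Π_{m+1}; segments Π cutPart i is the prefix ending at λ_{τ_i}.
  segments : (ℕ → List ℕ) → (ℕ → ℕ) → ℕ → List ℕ
  segments c d zero    = []
  segments c d (suc i) = segments c d i ++ (c (suc i) ++ d (suc i) ∷ [])

  assemble : (ℕ → List ℕ) → (ℕ → ℕ) → List ℕ
  assemble c d = segments c d m ++ c (suc m)

  module _ (c : ℕ → List ℕ) (d : ℕ → ℕ) where

    segments-+ : (k i : ℕ) → ∃ λ Q → segments c d (k + i) ≡ segments c d i ++ Q
    segments-+ zero    i = [] , sym (++-identityʳ _)
    segments-+ (suc k) i with Q , eq ← segments-+ k i =
      Q ++ (c (suc (k + i)) ++ d (suc (k + i)) ∷ []) ,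
      trans (cong (_++ _) eq) (++-assoc (segments c d i) Q _)

    assemble-prefix : (i : ℕ) → i ≤ m → ∃ λ R → assemble c d ≡ segments c d i ++ R
    assemble-prefix i i≤m with Q , eq ← segments-+ (m ∸ i) i =
      Q ++ c (suc m) , (begin
        segments c d m ++ c (suc m)              ≡⟨ cong (λ k → segments c d k ++ c (suc m)) (m∸n+n≡m i≤m) ⟨
        segments c d (m ∸ i + i) ++ c (suc m)    ≡⟨ cong (_++ c (suc m)) eq ⟩
        (segments c d i ++ Q) ++ c (suc m)       ≡⟨ ++-assoc (segments c d i) Q _ ⟩
        segments c d i ++ (Q ++ c (suc m))       ∎)
      where open ≡-Reasoning

    assemble-split : (i : ℕ) → i < m → ∃ λ R → assemble c d ≡ (segments c d i ++ c (suc i)) ++ d (suc i) ∷ R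
    assemble-split i i<m with R , eq ← assemble-prefix (suc i) i<m =
      R , (begin
        assemble c d                                           ≡⟨ eq ⟩
        (segments c d i ++ (c (suc i) ++ d (suc i) ∷ [])) ++ R ≡⟨ ++-assoc (segments c d i) _ R ⟩
        segments c d i ++ ((c (suc i) ++ d (suc i) ∷ []) ++ R) ≡⟨ cong (segments c d i ++_) (++-assoc (c (suc i)) _ R) ⟩
        segments c d i ++ (c (suc i) ++ d (suc i) ∷ R)         ≡⟨ ++-assoc (segments c d i) (c (suc i)) _ ⟨
        (segments c d i ++ c (suc i)) ++ d (suc i) ∷ R         ∎)
      where open ≡-Reasoning

    length-segments-suc : (i : ℕ) → length (segments c d (suc i)) ≡ suc (length (segments c d i ++ c (suc i)))
    length-segments-suc i = begin
      length (segments c d i ++ (c (suc i) ++ d (suc i) ∷ [])) ≡⟨ cong length (++-assoc (segments c d i) (c (suc i)) _) ⟨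
      length ((segments c d i ++ c (suc i)) ++ d (suc i) ∷ []) ≡⟨ length-++ (segments c d i ++ c (suc i)) ⟩
      length (segments c d i ++ c (suc i)) + 1                 ≡⟨ +-comm _ 1 ⟩
      suc (length (segments c d i ++ c (suc i)))               ∎
      where open ≡-Reasoning

    CutAt : ℕ → Set
    CutAt i = sum (segments c d i ++ c (suc i)) < suc i * q
            × suc i * q ≤ sum (segments c d i ++ c (suc i)) + d (suc i)

    -- Cuts says that the cut parts of assemble c d sit exactly at τ₁, …, τ_m.
    Cuts : Set
    Cuts = ∀ i → i < m → CutAt i

    module _ (cuts : Cuts) where

      assemble-crossing : (i : ℕ) → i < m → Crossing (assemble c d) (suc i * q)
      assemble-crossing i i<m with R , eq ← assemble-split i i<m =
        crossing (segments c d i ++ c (suc i)) (d (suc i)) R eq (proj₁ (cuts i i<m)) (proj₂ (cuts i i<m))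

      τ-assemble-suc : (i : ℕ) → i < m → τ n m (assemble c d) (suc i) ≡ suc (length (segments c d i ++ c (suc i)))
      τ-assemble-suc i i<m = firstReach-crossing (assemble-crossing i i<m)

      τ-assemble : (i : ℕ) → i ≤ m → τ n m (assemble c d) i ≡ length (segments c d i)
      τ-assemble zero    _   = firstReach-zero (assemble c d)
      τ-assemble (suc i) i<m = trans (τ-assemble-suc i i<m) (sym (length-segments-suc i))

      Π-assemble-< : (i : ℕ) → i < m → Π n m (assemble c d) (suc i) ≡ c (suc i)
      Π-assemble-< i i<m with R , eq ← assemble-split i i<m = begin
          Π n m (assemble c d) (suc i)
        ≡⟨ Π-< (assemble c d) i i<m ⟩
          take (τ n m (assemble c d) (suc i) ∸ 1 ∸ τ n m (assemble c d) i) (drop (τ n m (assemble c d) i) (assemble c d))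
        ≡⟨ cong₂ (λ t t′ → take (t ∸ 1 ∸ t′) (drop t′ (assemble c d))) (τ-assemble-suc i i<m) (τ-assemble i (<⇒≤ i<m)) ⟩
          take (length (S ++ c (suc i)) ∸ length S) (drop (length S) (assemble c d))
        ≡⟨ cong₂ (λ t l → take (t ∸ length S) (drop (length S) l)) (length-++ S) eq ⟩
          take (length S + length (c (suc i)) ∸ length S) (drop (length S) ((S ++ c (suc i)) ++ d (suc i) ∷ R))
        ≡⟨ cong₂ (λ t l → take t (drop (length S) l)) (m+n∸m≡n (length S) _) (++-assoc S _ _) ⟩
          take (length (c (suc i))) (drop (length S) (S ++ (c (suc i) ++ d (suc i) ∷ R)))
        ≡⟨ cong (take (length (c (suc i)))) (drop-length-++ S _) ⟩
          take (length (c (suc i))) (c (suc i) ++ d (suc i) ∷ R)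
        ≡⟨ take-length-++ (c (suc i)) _ ⟩
          c (suc i)
        ∎
        where
        open ≡-Reasoning
        S : List ℕ
        S = segments c d i

      Π-assemble : (i : ℕ) → i ≤ m → Π n m (assemble c d) (suc i) ≡ c (suc i)
      Π-assemble i i≤m with m≤n⇒m<n∨m≡n i≤m
      ... | inj₁ i<m  = Π-assemble-< i i<m
      ... | inj₂ refl = begin
        Π n m (assemble c d) (suc m)                       ≡⟨ Π-last (assemble c d) ⟩
        drop (τ n m (assemble c d) m) (assemble c d)       ≡⟨ cong (λ t → drop t (assemble c d)) (τ-assemble m ≤-refl) ⟩
        drop (length (segments c d m)) (assemble c d)      ≡⟨ drop-length-++ (segments c d m) _ ⟩
        c (suc m)                                          ∎
        where open ≡-Reasoning

      cutPart-assemble : (i : ℕ) → i < m → cutPart (assemble c d) (suc i) ≡ d (suc i)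
      cutPart-assemble i i<m with R , eq ← assemble-split i i<m =
        cong (λ l → fromMaybe 0 (head l))
          (trans (cong₂ (λ t l → drop (t ∸ 1) l) (τ-assemble-suc i i<m) eq)
                 (drop-length-++ (segments c d i ++ c (suc i)) (d (suc i) ∷ R)))

      pos-assemble : (i : ℕ) → i ≤ m → pos n m (assemble c d) (suc i) ≡ suc (sum (segments c d i))
      pos-assemble i i≤m with R , eq ← assemble-prefix i i≤m =
        cong (λ l → suc (sum l)) (trans (cong₂ take (τ-assemble i i≤m) eq) (take-length-++ (segments c d i) R))

  module OfList {l : List ℕ} (sum≡n : sum l ≡ n) (parts<q : All (_< q) l) (0<q : 0 < q) where

    private
      c : ℕ → List ℕ
      c = Π n m l
      d : ℕ → ℕ
      d = cutPart l

    threshold≤sum : (i : ℕ) → i ≤ m → i * q ≤ sum l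
    threshold≤sum i i≤m = begin
      i * q  ≤⟨ *-monoˡ-≤ q i≤m ⟩
      m * q  ≡⟨ *-comm m q ⟩
      q * m  ≤⟨ m/n*n≤m n m ⟩
      n      ≡⟨ sum≡n ⟨
      sum l  ∎
      where open ≤-Reasoning

    0<threshold : (i : ℕ) → 0 < suc i * q
    0<threshold i = ≤-trans 0<q (m≤m+n q (i * q))

    τ-<-suc : (i : ℕ) → i < m → (t : ℕ) → τ n m l (suc i) ≡ suc t → τ n m l i ≤ t
    τ-<-suc zero    _   t _  = subst (_≤ t) (sym (firstReach-zero l)) z≤n
    τ-<-suc (suc i) i<m t eq = ≤-pred (subst (τ n m l (suc i) <_) eq
      (firstReach-<-+ l (suc i * q) q parts<q (0<threshold i) (threshold≤sum (suc (suc i)) i<m)))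

    module AtCrossing (i : ℕ) (i<m : i < m) (cr : Crossing l (suc i * q)) where
      open Crossing cr

      τ-suc : τ n m l (suc i) ≡ suc (length before)
      τ-suc = firstReach-crossing cr

      τ≤ : τ n m l i ≤ length before
      τ≤ = τ-<-suc i i<m (length before) τ-suc

      block : c (suc i) ≡ drop (τ n m l i) before
      block = begin
          c (suc i)
        ≡⟨ Π-< l i i<m ⟩
          take (τ n m l (suc i) ∸ 1 ∸ k) (drop k l)
        ≡⟨ cong₂ (λ t l′ → take (t ∸ 1 ∸ k) (drop k l′)) τ-suc split ⟩
          take (length before ∸ k) (drop k (before ++ part ∷ after))
        ≡⟨ cong (take _) (drop-++-≤ k before _ τ≤) ⟩
          take (length before ∸ k) (drop k before ++ part ∷ after)
        ≡⟨ cong (λ t → take t (drop k before ++ _)) (length-drop k before) ⟨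
          take (length (drop k before)) (drop k before ++ part ∷ after)
        ≡⟨ take-length-++ (drop k before) _ ⟩
          drop k before
        ∎
        where
        open ≡-Reasoning
        k : ℕ
        k = τ n m l i

      cut : d (suc i) ≡ part
      cut = cong (λ l′ → fromMaybe 0 (head l′))
        (trans (cong₂ (λ t l′ → drop (t ∸ 1) l′) τ-suc split) (drop-length-++ before (part ∷ after)))

      take-τ-suc : take (τ n m l (suc i)) l ≡ before ++ part ∷ []
      take-τ-suc = trans (cong₂ take τ-suc split) (take-suc-length-++ before part after)

    segments-step : (i : ℕ) → i < m → take (τ n m l i) l ≡ segments c d i →
                    take (τ n m l (suc i)) l ≡ segments c d (suc i) × CutAt c d i
    segments-step i i<m take-τ≡ = take-τ-suc′ , cut-at
      where
      cr : Crossing l (suc i * q)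
      cr = crossing-exists l (suc i * q) (0<threshold i) (threshold≤sum (suc i) i<m)
      open Crossing cr
      open AtCrossing i i<m cr
      open ≡-Reasoning
      prefix : segments c d i ≡ take (τ n m l i) before
      prefix = begin
        segments c d i                                ≡⟨ take-τ≡ ⟨
        take (τ n m l i) l                            ≡⟨ cong (take _) split ⟩
        take (τ n m l i) (before ++ part ∷ after)     ≡⟨ take-++-≤ _ before _ τ≤ ⟩
        take (τ n m l i) before                       ∎
      segments-before : segments c d i ++ c (suc i) ≡ before
      segments-before = trans (cong₂ _++_ prefix block) (take++drop≡id (τ n m l i) before)
      take-τ-suc′ : take (τ n m l (suc i)) l ≡ segments c d (suc i)
      take-τ-suc′ = begin
        take (τ n m l (suc i)) l                         ≡⟨ take-τ-suc ⟩
        before ++ part ∷ []                              ≡⟨ cong₂ (λ a x → a ++ x ∷ []) segments-before cut ⟨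
        (segments c d i ++ c (suc i)) ++ d (suc i) ∷ []  ≡⟨ ++-assoc (segments c d i) (c (suc i)) _ ⟩
        segments c d (suc i)                             ∎
      cut-at : CutAt c d i
      cut-at rewrite segments-before | cut = below , reached

    take-τ : (i : ℕ) → i ≤ m → take (τ n m l i) l ≡ segments c d i
    take-τ zero    _   = cong (λ t → take t l) (firstReach-zero l)
    take-τ (suc i) i<m = proj₁ (segments-step i i<m (take-τ i (<⇒≤ i<m)))

    cuts : Cuts c d
    cuts i i<m = proj₂ (segments-step i i<m (take-τ i (<⇒≤ i<m)))

    decompose : l ≡ assemble c d
    decompose = begin
      l                                        ≡⟨ take++drop≡id (τ n m l m) l ⟨
      take (τ n m l m) l ++ drop (τ n m l m) l ≡⟨ cong₂ _++_ (take-τ m ≤-refl) (sym (Π-last l)) ⟩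
      segments c d m ++ c (suc m)              ∎
      where open ≡-Reasoning

  SameBlockSums : (ℕ → List ℕ) → (ℕ → List ℕ) → Set
  SameBlockSums c c′ = ∀ i → i ≤ m → sum (c (suc i)) ≡ sum (c′ (suc i))

  module _ {c c′ : ℕ → List ℕ} (d : ℕ → ℕ) (same : SameBlockSums c c′) where

    sum-segments-cong : (i : ℕ) → i ≤ m → sum (segments c d i) ≡ sum (segments c′ d i)
    sum-segments-cong zero    _   = refl
    sum-segments-cong (suc i) i<m =
      sum-++-cong (segments c d i) (segments c′ d i) (c (suc i) ++ d (suc i) ∷ []) (c′ (suc i) ++ d (suc i) ∷ [])
        (sum-segments-cong i (<⇒≤ i<m)) (sum-++-cong (c (suc i)) (c′ (suc i)) _ _ (same i (<⇒≤ i<m)) refl)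

    sum-assemble-cong : sum (assemble c d) ≡ sum (assemble c′ d)
    sum-assemble-cong = sum-++-cong (segments c d m) (segments c′ d m) (c (suc m)) (c′ (suc m))
      (sum-segments-cong m ≤-refl) (same m ≤-refl)

    Cuts-cong : Cuts c d → Cuts c′ d
    Cuts-cong cuts i i<m = subst (λ s → s < suc i * q × suc i * q ≤ s + d (suc i))
      (sum-++-cong (segments c d i) (segments c′ d i) (c (suc i)) (c′ (suc i))
        (sum-segments-cong i (<⇒≤ i<m)) (same i (<⇒≤ i<m))) (cuts i i<m)

  module _ {c c′ : ℕ → List ℕ} {d d′ : ℕ → ℕ} where

    segments-cong : (∀ i → i < m → c (suc i) ≡ c′ (suc i)) → (∀ i → i < m → d (suc i) ≡ d′ (suc i)) →
                    (i : ℕ) → i ≤ m → segments c d i ≡ segments c′ d′ i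
    segments-cong c≗c′ d≗d′ zero    _   = refl
    segments-cong c≗c′ d≗d′ (suc i) i<m =
      cong₂ _++_ (segments-cong c≗c′ d≗d′ i (<⇒≤ i<m)) (cong₂ (λ b x → b ++ x ∷ []) (c≗c′ i i<m) (d≗d′ i i<m))

    assemble-cong : (∀ i → i ≤ m → c (suc i) ≡ c′ (suc i)) → (∀ i → i < m → d (suc i) ≡ d′ (suc i)) →
                    assemble c d ≡ assemble c′ d′
    assemble-cong c≗c′ d≗d′ =
      cong₂ _++_ (segments-cong (λ i i<m → c≗c′ i (<⇒≤ i<m)) d≗d′ m ≤-refl) (c≗c′ m ≤-refl)

  module _ {Q : ℕ → Set} (c : ℕ → List ℕ) (d : ℕ → ℕ) where

    All-segments⁺ : (∀ i → i < m → All Q (c (suc i))) → (∀ i → i < m → Q (d (suc i))) →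
                    (i : ℕ) → i ≤ m → All Q (segments c d i)
    All-segments⁺ Qc Qd zero    _   = []
    All-segments⁺ Qc Qd (suc i) i<m =
      All.++⁺ (All-segments⁺ Qc Qd i (<⇒≤ i<m)) (All.++⁺ (Qc i i<m) (Qd i i<m ∷ []))

    All-assemble⁺ : (∀ i → i ≤ m → All Q (c (suc i))) → (∀ i → i < m → Q (d (suc i))) → All Q (assemble c d)
    All-assemble⁺ Qc Qd = All.++⁺ (All-segments⁺ (λ i i<m → Qc i (<⇒≤ i<m)) Qd m ≤-refl) (Qc m ≤-refl)

    All-assemble⁻-block : All Q (assemble c d) → (i : ℕ) → i ≤ m → All Q (c (suc i))
    All-assemble⁻-block Qa i i≤m with m≤n⇒m<n∨m≡n i≤m
    ... | inj₂ refl = All.++⁻ʳ (segments c d m) Qa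
    ... | inj₁ i<m with R , eq ← assemble-split c d i i<m =
      All.++⁻ʳ (segments c d i) (All.++⁻ˡ (segments c d i ++ c (suc i)) (subst (All Q) eq Qa))

    All-assemble⁻-cut : All Q (assemble c d) → (i : ℕ) → i < m → Q (d (suc i))
    All-assemble⁻-cut Qa i i<m with R , eq ← assemble-split c d i i<m
                               with Qd ∷ _ ← All.++⁻ʳ (segments c d i ++ c (suc i)) (subst (All Q) eq Qa) = Qd

-- Enumeration of Λ

words-complete : (xs l : List ℕ) → All (_∈ xs) l → l ∈ words xs (length l)
words-complete xs []      []           = here refl
words-complete xs (x ∷ l) (x∈xs ∷ l⊆xs) = ∈-concatMap⁺ (λ y → map (y ∷_) (words xs (length l)))
  (Any.map (λ { refl → ∈-map⁺ (x ∷_) (words-complete xs l l⊆xs) }) x∈xs)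

length-words : (xs : List ℕ) (t : ℕ) {w : List ℕ} → w ∈ words xs t → length w ≡ t
length-words xs zero (here refl) = refl
length-words xs (suc t) w∈ with ws , w∈ws , ws∈ ← ∈-concat⁻′ (map (λ x → map (x ∷_) (words xs t)) xs) w∈
                           with x , _ , refl ← ∈-map⁻ (λ x → map (x ∷_) (words xs t)) ws∈
                           with w′ , w′∈ , refl ← ∈-map⁻ (x ∷_) w∈ws = cong suc (length-words xs t w′∈)

words-unique : (xs : List ℕ) → Unique xs → (t : ℕ) → Unique (words xs t)
words-unique xs _      zero = [] ∷ []
words-unique xs unique (suc t) =
  Unique.concat⁺ (All.map⁺ (All.universal (λ x → Unique.map⁺ ∷-injectiveʳ (words-unique xs unique t)) xs))
                 (AllPairs.map⁺ (AllPairs.map disjoint unique))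
  where
  disjoint : ∀ {x y} → x ≢ y → ∀ {w} → ¬ (w ∈ map (x ∷_) (words xs t) × w ∈ map (y ∷_) (words xs t))
  disjoint x≢y (w∈x , w∈y) with _ , _ , refl ← ∈-map⁻ _ w∈x | _ , _ , eq ← ∈-map⁻ _ w∈y = x≢y (∷-injectiveˡ eq)

candidates-unique : (β n : ℕ) → Unique (candidates β n)
candidates-unique β n =
  Unique.concat⁺ (All.map⁺ (All.universal (words-unique digits digits-unique) (upTo (suc n))))
                 (AllPairs.map⁺ (AllPairs.map disjoint (Unique.upTo⁺ (suc n))))
  where
  digits : List ℕ
  digits = map suc (upTo β)
  digits-unique : Unique digits
  digits-unique = Unique.map⁺ suc-injective (Unique.upTo⁺ β)
  disjoint : ∀ {t t′} → t ≢ t′ → ∀ {w} → ¬ (w ∈ words digits t × w ∈ words digits t′)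
  disjoint t≢t′ (w∈ , w∈′) = t≢t′ (trans (sym (length-words digits _ w∈)) (length-words digits _ w∈′))

candidates-complete : (β n : ℕ) (l : List ℕ) → All (λ x → 1 ≤ x × x ≤ β) l → length l ≤ n → l ∈ candidates β n
candidates-complete β n l parts l≤n =
  ∈-concatMap⁺ (words (map suc (upTo β)))
    (Any.map (λ { refl → words-complete _ l (All.map digit parts) }) (∈-upTo⁺ (s≤s l≤n)))
  where
  digit : ∀ {x} → 1 ≤ x × x ≤ β → x ∈ map suc (upTo β)
  digit {suc x} (_ , x<β) = ∈-map⁺ suc (∈-upTo⁺ x<β)

length≤sum : (l : List ℕ) → All (1 ≤_) l → length l ≤ sum l
length≤sum []      []           = z≤n
length≤sum (x ∷ l) (1≤x ∷ 1≤l) = +-mono-≤ 1≤x (length≤sum l 1≤l)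

Allowed : List ℕ → ℕ → ℕ → Set
Allowed E β x = T (inS E x) × x ≤ β

module _ (E : List ℕ) (n β : ℕ) where

  ∈-Λ⁻ : {l : List ℕ} → l ∈ Λ E n β → All (Allowed E β) l × sum l ≡ n
  ∈-Λ⁻ {l} l∈ with _ , inΛ ← ∈-filter⁻ (λ l → T? (isInΛ E n β l)) {xs = candidates β n} l∈
              with inS-all , rest ← Equivalence.to T-∧ inΛ
              with ≤β-all , sum≡ ← Equivalence.to T-∧ rest =
    All.zip (All.all⁺ (inS E) l inS-all , All.map (≤ᵇ⇒≤ _ β) (All.all⁺ (_≤ᵇ β) l ≤β-all)) ,
    ≡ᵇ⇒≡ (sum l) n sum≡

  inS⇒1≤ : ∀ {x} → T (inS E x) → 1 ≤ x
  inS⇒1≤ {x} x∈S = ≤ᵇ⇒≤ 1 x (proj₁ (Equivalence.to T-∧ x∈S))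

  ∈-Λ⁺ : {l : List ℕ} → All (Allowed E β) l → sum l ≡ n → l ∈ Λ E n β
  ∈-Λ⁺ {l} allowed sum≡n = ∈-filter⁺ (λ l → T? (isInΛ E n β l)) {xs = candidates β n}
    (candidates-complete β n l (All.map (λ (x∈S , x≤β) → inS⇒1≤ x∈S , x≤β) allowed)
      (subst (length l ≤_) sum≡n (length≤sum l (All.map (λ a → inS⇒1≤ (proj₁ a)) allowed))))
    (Equivalence.from T-∧ (All.all⁻ (inS E) (All.map proj₁ allowed) ,
     Equivalence.from T-∧ (All.all⁻ (_≤ᵇ β) (All.map (λ a → ≤⇒≤ᵇ (proj₂ a)) allowed) , ≡⇒≡ᵇ (sum l) n sum≡n)))

  Λ-unique : Unique (Λ E n β)
  Λ-unique = Unique.filter⁺ (λ l → T? (isInΛ E n β l)) (candidates-unique β n)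

-- Swapping blocks inside Λ_{W⃗}

module Fibre (E : List ℕ) (n β m : ℕ) {{_ : NonZero m}} (β<q : β < n / m) (W : List (ℕ × ℕ)) where

  open Decomposition n m

  inFibre : List ℕ → Bool
  inFibre l = Wvec n m l ==W W

  fibre : List (List ℕ)
  fibre = filterᵇ inFibre (Λ E n β)

  fibre-unique : Unique fibre
  fibre-unique = Unique.filter⁺ (λ l → T? (inFibre l)) (Λ-unique E n β)

  ∈-fibre⁺ : {l : List ℕ} → All (Allowed E β) l → sum l ≡ n → Wvec n m l ≡ W → l ∈ fibre
  ∈-fibre⁺ allowed sum≡n W≡ =
    ∈-filter⁺ (λ l → T? (inFibre l)) {xs = Λ E n β} (∈-Λ⁺ E n β allowed sum≡n) (fromWitness W≡)

  module Member {l : List ℕ} (l∈ : l ∈ fibre) where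

    private
      l∈Λ : l ∈ Λ E n β
      l∈Λ = proj₁ (∈-filter⁻ (λ l → T? (inFibre l)) {xs = Λ E n β} l∈)

    allowed : All (Allowed E β) l
    allowed = proj₁ (∈-Λ⁻ E n β l∈Λ)

    sum≡n : sum l ≡ n
    sum≡n = proj₂ (∈-Λ⁻ E n β l∈Λ)

    W≡ : Wvec n m l ≡ W
    W≡ = toWitness (proj₂ (∈-filter⁻ (λ l → T? (inFibre l)) {xs = Λ E n β} l∈))

    open OfList sum≡n (All.map (λ a → ≤-<-trans (proj₂ a) β<q) allowed) (≤-<-trans z≤n β<q) public

  fibre-SameBlockSums : {x y : List ℕ} → x ∈ fibre → y ∈ fibre → SameBlockSums (Π n m x) (Π n m y)
  fibre-SameBlockSums x∈ y∈ i i≤m = cong proj₁ (Wvec-≡⁻ (trans (Member.W≡ x∈) (sym (Member.W≡ y∈))) i i≤m)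

  mixBlocks : ℕ → List ℕ → List ℕ → ℕ → List ℕ
  mixBlocks k x y i with i ≟ k
  ... | yes _ = Π n m x i
  ... | no  _ = Π n m y i

  mixBlocks-same : (k : ℕ) (x y : List ℕ) → mixBlocks k x y k ≡ Π n m x k
  mixBlocks-same k x y with k ≟ k
  ... | yes _   = refl
  ... | no  k≢k = contradiction refl k≢k

  mixBlocks-other : {k i : ℕ} (x y : List ℕ) → i ≢ k → mixBlocks k x y i ≡ Π n m y i
  mixBlocks-other {k} {i} x y i≢k with i ≟ k
  ... | yes i≡k = contradiction i≡k i≢k
  ... | no  _   = refl

  swap : ℕ → List ℕ → List ℕ → List ℕ
  swap k x y = assemble (mixBlocks k x y) (cutPart y)

  module Swap (k : ℕ) {x y : List ℕ} (x∈ : x ∈ fibre) (y∈ : y ∈ fibre) where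

    private
      module X = Member x∈
      module Y = Member y∈

    same-sums : SameBlockSums (Π n m y) (mixBlocks k x y)
    same-sums i i≤m with suc i ≟ k
    ... | yes _ = sym (fibre-SameBlockSums x∈ y∈ i i≤m)
    ... | no  _ = refl

    mixed-cuts : Cuts (mixBlocks k x y) (cutPart y)
    mixed-cuts = Cuts-cong (cutPart y) same-sums Y.cuts

    Π-swap : (i : ℕ) → i ≤ m → Π n m (swap k x y) (suc i) ≡ mixBlocks k x y (suc i)
    Π-swap = Π-assemble _ _ mixed-cuts

    cutPart-swap : (i : ℕ) → i < m → cutPart (swap k x y) (suc i) ≡ cutPart y (suc i)
    cutPart-swap = cutPart-assemble _ _ mixed-cuts

    pos-swap : (i : ℕ) → i ≤ m → pos n m (swap k x y) (suc i) ≡ pos n m y (suc i)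
    pos-swap i i≤m = begin
      pos n m (swap k x y) (suc i)                          ≡⟨ pos-assemble _ _ mixed-cuts i i≤m ⟩
      suc (sum (segments (mixBlocks k x y) (cutPart y) i))  ≡⟨ cong suc (sum-segments-cong (cutPart y) same-sums i i≤m) ⟨
      suc (sum (segments (Π n m y) (cutPart y) i))          ≡⟨ cong (λ s → suc (sum s)) (Y.take-τ i i≤m) ⟨
      pos n m y (suc i)                                     ∎
      where open ≡-Reasoning

    Wvec-swap : Wvec n m (swap k x y) ≡ W
    Wvec-swap = trans (Wvec-≡⁺ λ i i≤m →
      cong₂ _,_ (trans (cong sum (Π-swap i i≤m)) (sym (same-sums i i≤m))) (pos-swap i i≤m)) Y.W≡

    allowed-swap : All (Allowed E β) (swap k x y)
    allowed-swap = All-assemble⁺ _ _ allowed-blocks allowed-cuts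
      where
      allowed-x : All (Allowed E β) (assemble (Π n m x) (cutPart x))
      allowed-x = subst (All (Allowed E β)) X.decompose X.allowed
      allowed-y : All (Allowed E β) (assemble (Π n m y) (cutPart y))
      allowed-y = subst (All (Allowed E β)) Y.decompose Y.allowed
      allowed-blocks : ∀ i → i ≤ m → All (Allowed E β) (mixBlocks k x y (suc i))
      allowed-blocks i i≤m with suc i ≟ k
      ... | yes _ = All-assemble⁻-block _ _ allowed-x i i≤m
      ... | no  _ = All-assemble⁻-block _ _ allowed-y i i≤m
      allowed-cuts : ∀ i → i < m → Allowed E β (cutPart y (suc i))
      allowed-cuts = All-assemble⁻-cut _ _ allowed-y

    sum-swap : sum (swap k x y) ≡ n
    sum-swap = begin
      sum (swap k x y)                        ≡⟨ sum-assemble-cong (cutPart y) same-sums ⟨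
      sum (assemble (Π n m y) (cutPart y))    ≡⟨ cong sum Y.decompose ⟨
      sum y                                   ≡⟨ Y.sum≡n ⟩
      n                                       ∎
      where open ≡-Reasoning

    swap-∈ : swap k x y ∈ fibre
    swap-∈ = ∈-fibre⁺ allowed-swap sum-swap Wvec-swap

  swap-involutive : (k : ℕ) {x y : List ℕ} → x ∈ fibre → y ∈ fibre → swap k (swap k x y) (swap k y x) ≡ x
  swap-involutive k {x} {y} x∈ y∈ = begin
    assemble (mixBlocks k (swap k x y) (swap k y x)) (cutPart (swap k y x)) ≡⟨ assemble-cong blocks cuts ⟩
    assemble (Π n m x) (cutPart x)                                         ≡⟨ Member.decompose x∈ ⟨
    x                                                                      ∎
    where
    open ≡-Reasoning
    blocks : ∀ i → i ≤ m → mixBlocks k (swap k x y) (swap k y x) (suc i) ≡ Π n m x (suc i)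
    blocks i i≤m with suc i ≟ k
    ... | yes refl = trans (Swap.Π-swap k x∈ y∈ i i≤m) (mixBlocks-same (suc i) x y)
    ... | no  i≢k  = trans (Swap.Π-swap k y∈ x∈ i i≤m) (mixBlocks-other y x i≢k)
    cuts : ∀ i → i < m → cutPart (swap k y x) (suc i) ≡ cutPart x (suc i)
    cuts = Swap.cutPart-swap k y∈ x∈

  B-swap-same : (i : ℕ) → i ≤ m → {x y : List ℕ} → x ∈ fibre → y ∈ fibre →
                B n m (swap (suc i) x y) (suc i) ≡ B n m x (suc i)
  B-swap-same i i≤m {x} {y} x∈ y∈ =
    cong product (trans (Swap.Π-swap (suc i) x∈ y∈ i i≤m) (mixBlocks-same (suc i) x y))

  B-swap-other : {k i : ℕ} → suc i ≢ k → i ≤ m → {x y : List ℕ} → x ∈ fibre → y ∈ fibre →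
                 B n m (swap k x y) (suc i) ≡ B n m y (suc i)
  B-swap-other i≢k i≤m {x} {y} x∈ y∈ =
    cong product (trans (Swap.Π-swap _ x∈ y∈ _ i≤m) (mixBlocks-other x y i≢k))

  module _ (b : Fin (suc m) → ℕ) where

    B≡ : Fin (suc m) → List ℕ → Bool
    B≡ j l = B n m l (suc (toℕ j)) ≡ᵇ b j

    B≡-swaps : CoordinateSwaps fibre B≡
    B≡-swaps = record
      { swap            = λ j → swap (suc (toℕ j))
      ; swap-∈          = λ j → Swap.swap-∈ (suc (toℕ j))
      ; swap-involutive = λ j → swap-involutive (suc (toℕ j))
      ; P-swap-same     = λ j x∈ y∈ → cong (_≡ᵇ b j) (B-swap-same (toℕ j) (≤-pred (toℕ<n j)) x∈ y∈)
      ; P-swap-other    = λ {i} j≢i x∈ y∈ → cong (_≡ᵇ b i)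
          (B-swap-other (λ i≡j → j≢i (toℕ-injective (suc-injective (sym i≡j)))) (≤-pred (toℕ<n i)) x∈ y∈)
      }

theorem9 : (E : List ℕ) → E ≢ [] → All (λ k → 1 ≤ k) E →
    (n β m : ℕ) → {{_ : NonZero m}} → 1 ≤ n → 1 ≤ β →
    2 * β < n / m → Λ E n β ≢ [] →
    (W : List (ℕ × ℕ)) →
    filterᵇ (λ l → Wvec n m l ==W W) (Λ E n β) ≢ [] →
    (b : Fin (suc m) → ℕ) →
    length (filterᵇ (λ l → (Wvec n m l ==W W) ∧ all (λ i → B n m l (suc (toℕ i)) ≡ᵇ b i) (allFin (suc m))) (Λ E n β))
      * length (filterᵇ (λ l → Wvec n m l ==W W) (Λ E n β)) ^ m
    ≡ product (map (λ i → length (filterᵇ (λ l → (Wvec n m l ==W W) ∧ (B n m l (suc (toℕ i)) ≡ᵇ b i)) (Λ E n β))) (allFin (suc m)))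
theorem9 E _ _ n β m _ _ 2β<q _ W _ b = begin
    count (λ l → inFibre l ∧ all-blocks l) (Λ E n β) * N ^ m
  ≡⟨ cong (_* N ^ m) (count-∧-filterᵇ inFibre all-blocks (Λ E n β)) ⟩
    count all-blocks fibre * N ^ m
  ≡⟨ cong (λ t → count all-blocks fibre * N ^ t) (length-tabulate {n = m} Fin.suc) ⟨
    count all-blocks fibre * N ^ length (tabulate {n = m} Fin.suc)
  -- allFin (suc m) reduces to Fin.zero ∷ tabulate Fin.suc
  ≡⟨ count-all fibre-unique (B≡-swaps b) Fin.zero _ (Unique.allFin⁺ (suc m)) ⟩
    product (map (λ j → count (B≡ b j) fibre) (allFin (suc m)))
  ≡⟨ cong product (map-cong (λ j → count-∧-filterᵇ inFibre (B≡ b j) (Λ E n β)) (allFin (suc m))) ⟨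
    product (map (λ j → count (λ l → inFibre l ∧ B≡ b j l) (Λ E n β)) (allFin (suc m)))
  ∎
  where
  open ≡-Reasoning
  open Fibre E n β m (≤-<-trans (m≤m+n β (β + 0)) 2β<q) W
  N : ℕ
  N = length fibre
  all-blocks : List ℕ → Bool
  all-blocks l = all (λ j → B≡ b j l) (allFin (suc m))
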